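{- Assuming the axiom of choice, there exists a problem $f:\subseteq\mathbb{N}^\mathbb{N}\rightrightarrows\mathbb{N}^\mathbb{N}$ that is discontinuous but not effectively discontinuous.
   Context: A problem $f:\subseteq\mathbb{N}^\mathbb{N}\rightrightarrows\mathbb{N}^\mathbb{N}$ is a partial multivalued function with a realizer $F$ ($F(p)\in f(p)$ for $p\in\mathrm{dom}(f)$); it is continuous if it has a continuous realizer, discontinuous otherwise. $\Phi$ is the standard total representation of continuous partial functions on Baire space ($\Phi_q(p)=\sup_{w\sqsubseteq p}h(w)$ for the monotone word function $h$ whose graph is listed by $q$; every continuous partial function has an extension $\Phi_q$). $f$ is effectively discontinuous if there is a continuous total $D:\mathbb{N}^\mathbb{N}\to\mathbb{N}^\mathbb{N}$ with $D(q)\in\mathrm{dom}(f)$ and $\Phi_qD(q)\notin f(D(q))$ for all $q$ (counted as satisfied when $\Phi_qD(q)$ is undefined). -}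

module Defs where

open import Data.Nat using (ℕ; zero; suc; _<_)
open import Data.List using (List; []; _∷_; length)
open import Data.Product using (Σ; _×_; _,_; ∃; proj₁; proj₂)
open import Data.Unit using (⊤)
open import Relation.Nullary using (¬_; Dec)
open import Relation.Binary.PropositionalEquality using (_≡_)
open import Relation.Binary.Structures using (IsStrictTotalOrder)
open import Induction.WellFounded using (WellFounded)

Baire : Set
Baire = ℕ → ℕ

Agree : ℕ → Baire → Baire → Set
Agree n p p' = ∀ i → i < n → p i ≡ p' i

_≺_ : List ℕ → Baire → Set
[] ≺ p = ⊤
(a ∷ w) ≺ p = (a ≡ p 0) × (w ≺ (λ i → p (suc i)))

record Problem : Set₁ where
  field
    Dom : Baire → Set
    Val : Baire → Baire → Set
    nonempty : ∀ p → Dom p → Σ Baire (Val p)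
open Problem public

IsRealizer : (f : Problem) → ((p : Baire) → Dom f p → Baire) → Set
IsRealizer f g = ∀ p (d : Dom f p) → Val f p (g p d)

IsContinuousOn : (f : Problem) → ((p : Baire) → Dom f p → Baire) → Set
IsContinuousOn f g =
  ∀ p (d : Dom f p) (n : ℕ) → ∃ λ m → ∀ p' (d' : Dom f p') →
    Agree m p p' → Agree n (g p d) (g p' d')

Continuous : Problem → Set
Continuous f = Σ ((p : Baire) → Dom f p → Baire) λ g → IsRealizer f g × IsContinuousOn f g

Discontinuous : Problem → Set
Discontinuous f = ¬ Continuous f

IsContinuous : (Baire → Baire) → Set
IsContinuous D = ∀ q n → ∃ λ m → ∀ q' → Agree m q q' → Agree n (D q) (D q')

-- Coding of words: diagonal (Cantor) enumeration of ℕ × ℕ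
unpair : ℕ → ℕ × ℕ
unpair zero = 0 , 0
unpair (suc n) with unpair n
... | zero , b = suc b , 0
... | suc a , b = a , suc b

-- code 0 is the empty word, code (suc n) with unpair n = (a , c) is a ∷ (word coded by c)
decodeListF : ℕ → ℕ → List ℕ
decodeListF zero _ = []
decodeListF (suc f) zero = []
decodeListF (suc f) (suc n) = proj₁ (unpair n) ∷ decodeListF f (proj₂ (unpair n))

decodeList : ℕ → List ℕ
decodeList n = decodeListF n n

-- each q(i) codes a pair (w , v) of words, an entry of the graph of a word function
decodePair : ℕ → List ℕ × List ℕ
decodePair n = decodeList (proj₁ (unpair n)) , decodeList (proj₂ (unpair n))

-- Φ_q(p) = r : the sup over listed entries (w,v) with w ⊑ p of v is the infinite sequence r
ΦGraph : Baire → Baire → Baire → Set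
ΦGraph q p r =
  (∀ n → ∃ λ i → proj₁ (decodePair (q i)) ≺ p × n < length (proj₂ (decodePair (q i))))
  × (∀ i → proj₁ (decodePair (q i)) ≺ p → proj₂ (decodePair (q i)) ≺ r)

EffectivelyDiscontinuous : Problem → Set
EffectivelyDiscontinuous f =
  Σ (Baire → Baire) λ D → IsContinuous D ×
    (∀ q → Dom f (D q) × (∀ r → ΦGraph q (D q) r → ¬ Val f (D q) r))

-- Classical set-theoretic background (ZFC): excluded middle and the
-- well-ordering theorem (equivalent to the axiom of choice)
ExcludedMiddle : Set₁
ExcludedMiddle = (P : Set) → Dec P

WellOrderingTheorem : Set₁
WellOrderingTheorem = (A : Set) → Σ (A → A → Set) λ _<_ →
  IsStrictTotalOrder _≡_ _<_ × WellFounded _<_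

-- Well-order Baire space. Below the least point whose initial segment maps onto Baire space
-- every initial segment is small, and every pair (k , F) with F continuous is scheduled at a
-- small stage y. By transfinite recursion stage y assigns a value c(p) to a single point p not
-- assigned earlier; smallness guarantees such points exist. For k = 0 it takes a fresh p and sets
-- c(p) := F(p), so F does not realize "output anything other than c(p)". For k ≠ 0 it takes the
-- least a with F(a) fresh and sets c(F a) := a + 1. A witness D of effective discontinuity forces
-- c(D (code of the constant function a)) = a for every a, so for F = D ∘ code the stage either
-- breaks this at a fresh F(a), or finds every F(b) assigned earlier, and then b ↦ c(F b) maps the
-- small initial segment onto Baire space.

module Submission where

open import Defs
open import Data.Empty using (⊥; ⊥-elim)
open import Data.List using (List; []; _∷_; length)
open import Data.Maybe using (Maybe; just; nothing)
import Data.Maybe as Maybe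
open import Data.Nat using (ℕ; zero; suc; _<_; _≤_; _+_; z≤n; s≤s)
open import Data.Nat.Properties
  using (≤-refl; ≤-reflexive; ≤-trans; <⇒≤; n≤1+n; m≤m+n; m≤n+m; m+n≤o⇒n≤o; +-suc; +-identityʳ; 1+n≢n)
open import Data.Product using (Σ; ∃; ∃-syntax; _×_; _,_; proj₁; proj₂; uncurry)
open import Data.Unit using (⊤; tt)
open import Function using (id; _∘_)
open import Induction.WellFounded using (WellFounded; WfRec; module All; module FixPoint)
open import Relation.Binary.Definitions using (tri<; tri≈; tri>)
open import Relation.Binary.PropositionalEquality
  using (_≡_; refl; sym; trans; cong; cong₂; cong-app; subst; _≗_; module ≡-Reasoning)
open import Relation.Binary.Structures using (IsStrictTotalOrder)
open import Relation.Nullary using (¬_; yes; no)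
open import Relation.Nullary.Decidable using (decidable-stable)

unpairNext : ℕ × ℕ → ℕ × ℕ
unpairNext (zero  , b) = suc b , 0
unpairNext (suc a , b) = a , suc b

unpair-suc : ∀ n → unpair (suc n) ≡ unpairNext (unpair n)
unpair-suc n with unpair n
... | zero  , b = refl
... | suc a , b = refl

-- unpair runs through each diagonal a + b = d from (d , 0) down to (0 , d).
unpair-onto : ∀ d a b → a + b ≡ d → ∃[ n ] unpair n ≡ (a , b)
unpair-onto d a (suc b) a+1+b≡d
  with n , e ← unpair-onto d (suc a) b (trans (sym (+-suc a b)) a+1+b≡d)
  = suc n , trans (unpair-suc n) (cong unpairNext e)
unpair-onto zero zero zero _ = 0 , refl
unpair-onto (suc d) a zero a+0≡1+d with refl ← trans (sym (+-identityʳ a)) a+0≡1+d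
  with n , e ← unpair-onto d 0 d refl
  = suc n , trans (unpair-suc n) (cong unpairNext e)

pair : ℕ → ℕ → ℕ
pair a b = proj₁ (unpair-onto (a + b) a b refl)

unpair-pair : ∀ a b → unpair (pair a b) ≡ (a , b)
unpair-pair a b = proj₂ (unpair-onto (a + b) a b refl)

unpairNext-sum-≤ : ∀ x → uncurry _+_ (unpairNext x) ≤ suc (uncurry _+_ x)
unpairNext-sum-≤ (zero  , b) = s≤s (≤-reflexive (+-identityʳ b))
unpairNext-sum-≤ (suc a , b) = ≤-trans (≤-reflexive (+-suc a b)) (n≤1+n _)

unpair-sum-≤ : ∀ n → uncurry _+_ (unpair n) ≤ n
unpair-sum-≤ zero = z≤n
unpair-sum-≤ (suc n) rewrite unpair-suc n =
  ≤-trans (unpairNext-sum-≤ (unpair n)) (s≤s (unpair-sum-≤ n))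

pair-≥ : ∀ a b → b ≤ pair a b
pair-≥ a b = m+n≤o⇒n≤o a
  (subst (λ x → uncurry _+_ x ≤ pair a b) (unpair-pair a b) (unpair-sum-≤ (pair a b)))

encodeList : List ℕ → ℕ
encodeList []      = 0
encodeList (a ∷ w) = suc (pair a (encodeList w))

decodeListF-encodeList : ∀ fuel w → encodeList w ≤ fuel → decodeListF fuel (encodeList w) ≡ w
decodeListF-encodeList zero    []      _ = refl
decodeListF-encodeList (suc _) []      _ = refl
decodeListF-encodeList (suc fuel) (a ∷ w) (s≤s w<fuel) rewrite unpair-pair a (encodeList w) =
  cong (a ∷_) (decodeListF-encodeList fuel w (≤-trans (pair-≥ a (encodeList w)) w<fuel))

decodeList-encodeList : ∀ w → decodeList (encodeList w) ≡ w
decodeList-encodeList w = decodeListF-encodeList (encodeList w) w ≤-refl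

cons : ℕ → Baire → Baire
cons x p zero    = x
cons x p (suc i) = p i

tail : Baire → Baire
tail p = p ∘ suc

prefix : ℕ → Baire → List ℕ
prefix zero    p = []
prefix (suc n) p = p 0 ∷ prefix n (tail p)

prefix-length : ∀ n p → length (prefix n p) ≡ n
prefix-length zero    p = refl
prefix-length (suc n) p = cong suc (prefix-length n (tail p))

prefix-≺ : ∀ n p → prefix n p ≺ p
prefix-≺ zero    p = tt
prefix-≺ (suc n) p = refl , prefix-≺ n (tail p)

prefix-cong : ∀ n {p q} → Agree n p q → prefix n p ≡ prefix n q
prefix-cong zero    _       = refl
prefix-cong (suc n) p≈ₙ₊₁q =
  cong₂ _∷_ (p≈ₙ₊₁q 0 (s≤s z≤n)) (prefix-cong n (λ i i<n → p≈ₙ₊₁q (suc i) (s≤s i<n)))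

Agree-≤ : ∀ {m n p q} → n ≤ m → Agree m p q → Agree n p q
Agree-≤ n≤m p≈q i i<n = p≈q i (≤-trans i<n n≤m)

padZeros : List ℕ → Baire
padZeros []      _       = 0
padZeros (x ∷ w) zero    = x
padZeros (x ∷ w) (suc i) = padZeros w i

Agree-padZeros-prefix : ∀ m p → Agree m p (padZeros (prefix m p))
Agree-padZeros-prefix (suc m) p zero    _         = refl
Agree-padZeros-prefix (suc m) p (suc i) (s≤s i<m) = Agree-padZeros-prefix m (tail p) i i<m

dense : ℕ → Baire
dense k = padZeros (decodeList k)

dense-approximates : ∀ m p → Agree m p (dense (encodeList (prefix m p)))
dense-approximates m p rewrite decodeList-encodeList (prefix m p) = Agree-padZeros-prefix m p

∘-continuous : ∀ {F G} → IsContinuous F → IsContinuous G → IsContinuous (F ∘ G)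
∘-continuous {F} {G} F-cont G-cont q n =
  let m , F-mod = F-cont (G q) n
      k , G-mod = G-cont q m
  in k , λ q′ q≈q′ → F-mod (G q′) (G-mod q′ q≈q′)

continuous-≗-on-dense : ∀ {F G} → IsContinuous F → IsContinuous G →
  (∀ k → F (dense k) ≗ G (dense k)) → ∀ p → F p ≗ G p
continuous-≗-on-dense {F} {G} F-cont G-cont F≗G p i = begin
  F p i ≡⟨ F-mod d (Agree-≤ (m≤m+n mF mG) p≈d) i ≤-refl ⟩
  F d i ≡⟨ F≗G k i ⟩
  G d i ≡⟨ sym (G-mod d (Agree-≤ (m≤n+m mG mF) p≈d) i ≤-refl) ⟩
  G p i ∎
  where
  open ≡-Reasoning
  mF = proj₁ (F-cont p (suc i))
  F-mod = proj₂ (F-cont p (suc i))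
  mG = proj₁ (G-cont p (suc i))
  G-mod = proj₂ (G-cont p (suc i))
  k = encodeList (prefix (mF + mG) p)
  d = dense k
  p≈d = dense-approximates (mF + mG) p

-- Entry i lists the pair ([] , first i digits of a), so Φ (constCode a) is constantly a.
constCode : Baire → Baire
constCode a i = pair 0 (encodeList (prefix i a))

decodePair-constCode : ∀ a i → decodePair (constCode a i) ≡ ([] , prefix i a)
decodePair-constCode a i rewrite unpair-pair 0 (encodeList (prefix i a)) =
  cong ([] ,_) (decodeList-encodeList (prefix i a))

ΦGraph-constCode : ∀ a p → ΦGraph (constCode a) p a
ΦGraph-constCode a p = covers , consistent
  where
  covers : ∀ n → ∃ λ i → proj₁ (decodePair (constCode a i)) ≺ p
                        × n < length (proj₂ (decodePair (constCode a i)))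
  covers n = suc n , subst (λ (w , v) → w ≺ p × n < length v) (sym (decodePair-constCode a (suc n)))
                       (tt , subst (n <_) (sym (prefix-length (suc n) a)) ≤-refl)
  consistent : ∀ i → proj₁ (decodePair (constCode a i)) ≺ p → proj₂ (decodePair (constCode a i)) ≺ a
  consistent i _ = subst (λ (_ , v) → v ≺ a) (sym (decodePair-constCode a i)) (prefix-≺ i a)

constCode-continuous : IsContinuous constCode
constCode-continuous a n = n , λ a′ a≈a′ i i<n →
  cong (pair 0 ∘ encodeList) (prefix-cong i (Agree-≤ (<⇒≤ i<n) a≈a′))

Represents : Baire → (Baire → Baire) → Set
Represents b G = ∀ k j → G (dense k) j ≡ b (pair k j)

code : (Baire → Baire) → Baire
code F n = F (dense (proj₁ (unpair n))) (proj₂ (unpair n))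

represents-code : ∀ {F b} → b ≗ code F → Represents b F
represents-code {F} b≗code k j rewrite b≗code (pair k j) | unpair-pair k j = refl

Avoiding : (Baire → Baire) → Problem
Avoiding g = record
  { Dom      = λ _ → ⊤
  ; Val      = λ p r → ¬ (r ≗ g p)
  ; nonempty = λ p _ → suc ∘ g p , λ r≗gp → 1+n≢n (r≗gp 0)
  }

module Classical (lem : ExcludedMiddle) where

  stable : {P : Set} → ¬ ¬ P → P
  stable = decidable-stable (lem _)

  decode : Baire → Baire → Baire
  decode b with lem (∃ λ G → IsContinuous G × Represents b G)
  ... | yes (G , _) = G
  ... | no _        = id

  decode-≗ : ∀ {F b} → IsContinuous F → Represents b F → ∀ p → decode b p ≗ F p
  decode-≗ {F} {b} F-cont F-rep p with lem (∃ λ G → IsContinuous G × Represents b G)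
  ... | yes (G , G-cont , G-rep) =
    continuous-≗-on-dense G-cont F-cont (λ k j → trans (G-rep k j) (sym (F-rep k j))) p
  ... | no ¬G = ⊥-elim (¬G (F , F-cont , F-rep))

  module WellOrdered {A : Set} {_⊏_ : A → A → Set}
    (sto : IsStrictTotalOrder _≡_ _⊏_) (wf : WellFounded _⊏_) where

    open IsStrictTotalOrder sto using (compare)

    IsLeast : (A → Set) → A → Set
    IsLeast P x = P x × (∀ {y} → y ⊏ x → ¬ P y)

    least : ∀ {P} → Σ A P → Σ A (IsLeast P)
    least {P} (x , px) = All.wfRec wf _ (λ x → P x → Σ A (IsLeast P)) descend x px
      where
      descend : ∀ x → WfRec _⊏_ (λ x → P x → Σ A (IsLeast P)) x → P x → Σ A (IsLeast P)
      descend x below px with lem (∃ λ y → y ⊏ x × P y)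
      ... | yes (y , y⊏x , py) = below y⊏x py
      ... | no ¬smaller        = x , px , λ y⊏x py → ¬smaller (_ , y⊏x , py)

    IsLeast-unique : ∀ {P Q x y} → (∀ {z} → P z → Q z) → (∀ {z} → Q z → P z) →
                     IsLeast P x → IsLeast Q y → x ≡ y
    IsLeast-unique {x = x} {y} P⇒Q Q⇒P (px , x-least) (qy , y-least) with compare x y
    ... | tri< x⊏y _ _ = ⊥-elim (y-least x⊏y (P⇒Q px))
    ... | tri≈ _ x≡y _ = x≡y
    ... | tri> _ _ y⊏x = ⊥-elim (x-least y⊏x (Q⇒P qy))

    choose : (A → Set) → Maybe A
    choose P with lem (Σ A P)
    ... | yes w = just (proj₁ (least w))
    ... | no _  = nothing

    choose-sound : ∀ {P x} → choose P ≡ just x → P x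
    choose-sound {P} eq with lem (Σ A P)
    choose-sound eq | yes w with refl ← eq = proj₁ (proj₂ (least w))

    choose-complete : ∀ {P} → Σ A P → ∃ λ x → choose P ≡ just x
    choose-complete {P} w with lem (Σ A P)
    ... | yes _ = _ , refl
    ... | no ¬w = ⊥-elim (¬w w)

    choose-cong : ∀ {P Q} → (∀ {x} → P x → Q x) → (∀ {x} → Q x → P x) → choose P ≡ choose Q
    choose-cong {P} {Q} P⇒Q Q⇒P with lem (Σ A P) | lem (Σ A Q)
    ... | yes w | yes w′      = cong just (IsLeast-unique P⇒Q Q⇒P (proj₂ (least w)) (proj₂ (least w′)))
    ... | yes (x , px) | no ¬w = ⊥-elim (¬w (x , P⇒Q px))
    ... | no ¬w | yes (x , qx) = ⊥-elim (¬w (x , Q⇒P qx))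
    ... | no _ | no _          = refl

module Construction (lem : ExcludedMiddle) {_⊏_ : Baire → Baire → Set}
  (sto : IsStrictTotalOrder _≡_ _⊏_) (wf : WellFounded _⊏_) where

  open Classical lem
  open WellOrdered sto wf
  open IsStrictTotalOrder sto using (compare)

  OntoFrom : (Baire → Set) → (Baire → Baire) → Set
  OntoFrom I h = ∀ b → ∃ λ y → I y × h y ≗ b

  Small : Baire → Set
  Small y = ∀ h → ¬ OntoFrom (_⊏ y) h

  small-enumeration : Σ (Baire → Baire) λ σ → ∀ b → ∃ λ y → σ y ≗ b × Small y
  small-enumeration with lem (∃ λ x → ∃ (OntoFrom (_⊏ x)))
  ... | no ¬large = id , λ b → b , (λ _ → refl) , λ h onto → ¬large (b , h , onto)
  ... | yes large with least large
  ...   | _ , (h , onto) , below-small = h , λ b →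
    let y , y⊏x , hy≗b = onto b in y , hy≗b , λ h′ onto′ → below-small y⊏x (h′ , onto′)

  σ : Baire → Baire
  σ = proj₁ small-enumeration

  taskOf : ℕ → (Baire → Baire) → (Baire → Baire) × (Baire → Baire)
  taskOf zero    G = id , G
  taskOf (suc _) G = G , λ a → suc ∘ a

  -- σ y is read as a kind k followed by the code of a continuous G; stage y then assigns
  -- c (point y a) := value y a for the least a whose point is still fresh.
  task : Baire → (Baire → Baire) × (Baire → Baire)
  task y = taskOf (σ y 0) (decode (tail (σ y)))

  point value : Baire → Baire → Baire
  point y = proj₁ (task y)
  value y = proj₂ (task y)

  Out : Set
  Out = Maybe (Baire × Baire)

  Defines : Out → Baire → Set
  Defines nothing         _ = ⊥
  Defines (just (p′ , _)) p = p′ ≗ p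

  Defines-≗ : ∀ o {p q} → p ≗ q → Defines o p → Defines o q
  Defines-≗ (just _) p≗q p′≗p i = trans (p′≗p i) (p≗q i)

  outPoint outValue : Out → Baire
  outPoint nothing        = λ _ → 0
  outPoint (just (p , _)) = p
  outValue nothing        = λ _ → 0
  outValue (just (_ , v)) = v

  Defines⇒outPoint : ∀ o {p} → Defines o p → outPoint o ≗ p
  Defines⇒outPoint (just _) p′≗p = p′≗p

  Fixed : ∀ {y} → WfRec _⊏_ (λ _ → Out) y → Baire → Set
  Fixed {y} earlier p = ∃ λ y′ → Σ (y′ ⊏ y) λ y′⊏y → Defines (earlier y′⊏y) p

  stageStep : ∀ y → WfRec _⊏_ (λ _ → Out) y → Out
  stageStep y earlier =
    Maybe.map (λ a → point y a , value y a) (choose (λ a → ¬ Fixed earlier (point y a)))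

  Fixed-cong : ∀ {y} {earlier earlier′ : WfRec _⊏_ (λ _ → Out) y} →
    (∀ {y′} (y′⊏y : y′ ⊏ y) → earlier y′⊏y ≡ earlier′ y′⊏y) →
    ∀ {p} → Fixed earlier p → Fixed earlier′ p
  Fixed-cong same {p} (y′ , y′⊏y , defines) =
    y′ , y′⊏y , subst (λ o → Defines o p) (same y′⊏y) defines

  stageStep-ext : ∀ y {earlier earlier′ : WfRec _⊏_ (λ _ → Out) y} →
    (∀ {y′} (y′⊏y : y′ ⊏ y) → earlier y′⊏y ≡ earlier′ y′⊏y) →
    stageStep y earlier ≡ stageStep y earlier′
  stageStep-ext y same =
    cong (Maybe.map _) (choose-cong (_∘ Fixed-cong (sym ∘ same)) (_∘ Fixed-cong same))

  stage : Baire → Out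
  stage = All.wfRec wf _ (λ _ → Out) stageStep

  FixedBefore : Baire → Baire → Set
  FixedBefore y = Fixed {y} (λ {y′} _ → stage y′)

  stage-unfold : ∀ y →
    stage y ≡ Maybe.map (λ a → point y a , value y a) (choose (λ a → ¬ FixedBefore y (point y a)))
  stage-unfold y = FixPoint.unfold-wfRec wf _ stageStep stageStep-ext

  FixedBefore-≗ : ∀ {y q r} → q ≗ r → FixedBefore y q → FixedBefore y r
  FixedBefore-≗ q≗r (y′ , y′⊏y , defines) = y′ , y′⊏y , Defines-≗ (stage y′) q≗r defines

  stage-fresh : ∀ y {p} → Defines (stage y) p → ¬ FixedBefore y p
  stage-fresh y {p} rewrite stage-unfold y with choose (λ a → ¬ FixedBefore y (point y a)) in eq
  ... | just a  = λ pa≗p fixed → choose-sound eq (FixedBefore-≗ (λ i → sym (pa≗p i)) fixed)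
  ... | nothing = λ ()

  stage-acts : ∀ y {P V} → task y ≡ (P , V) → (∃ λ a → ¬ FixedBefore y (P a)) →
               ∃ λ a → stage y ≡ just (P a , V a)
  stage-acts y refl pending with choose-complete pending
  ... | a , chosen = a , trans (stage-unfold y) (cong (Maybe.map _) chosen)

  c : Baire → Baire
  c p with lem (∃ λ s → Defines (stage s) p)
  ... | yes (s , _) = outValue (stage s)
  ... | no _        = λ _ → 0

  c-defined : ∀ {s p} → Defines (stage s) p → c p ≡ outValue (stage s)
  c-defined {s} {p} defines with lem (∃ λ s → Defines (stage s) p)
  ... | no ¬assigned = ⊥-elim (¬assigned (s , defines))
  ... | yes (s′ , defines′) with compare s′ s
  ...   | tri< s′⊏s _ _ = ⊥-elim (stage-fresh s defines (s′ , s′⊏s , defines′))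
  ...   | tri≈ _ refl _ = refl
  ...   | tri> _ _ s⊏s′ = ⊥-elim (stage-fresh s′ defines′ (s , s⊏s′ , defines))

  c-at-stage : ∀ {s p v p′} → stage s ≡ just (p , v) → p ≗ p′ → c p′ ≡ v
  c-at-stage {s} {p′ = p′} eq p≗p′ =
    trans (c-defined (subst (λ o → Defines o p′) (sym eq) p≗p′)) (cong outValue eq)

  small-has-fresh : ∀ {y} → Small y → ∃ λ p → ¬ FixedBefore y p
  small-has-fresh {y} small = stable λ ¬fresh → small (outPoint ∘ stage) λ b →
    let y′ , y′⊏y , defines = stable {FixedBefore y b} (λ ¬fixed → ¬fresh (b , ¬fixed))
    in y′ , y′⊏y , Defines⇒outPoint (stage y′) defines

  task-scheduled : ∀ k {F} → IsContinuous F → ∃ λ y → Small y ×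
    Σ (Baire → Baire) λ G → task y ≡ taskOf k G × (∀ p → G p ≗ F p)
  task-scheduled k {F} F-cont =
    let y , σy≗ , small = proj₂ small-enumeration (cons k (code F))
        G = decode (tail (σ y))
    in y , small , G , cong (λ k → taskOf k G) (σy≗ 0) ,
       decode-≗ F-cont (represents-code {F} (σy≗ ∘ suc))

  discontinuous : Discontinuous (Avoiding c)
  discontinuous (g , realizes , g-cont) =
    let y , small , G , task-y , G≗F = task-scheduled 0 F-cont
        a , stage-y = stage-acts y task-y (small-has-fresh small)
    in realizes a tt λ i → trans (sym (G≗F a i)) (sym (cong-app (c-at-stage stage-y λ _ → refl) i))
    where
    F : Baire → Baire
    F p = g p tt
    F-cont : IsContinuous F
    F-cont q n = let m , g-mod = g-cont q tt n in m , λ q′ → g-mod q′ tt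

  witness-inverts-c : ∀ {D : Baire → Baire} →
    (∀ q → Dom (Avoiding c) (D q) × (∀ r → ΦGraph q (D q) r → ¬ Val (Avoiding c) (D q) r)) →
    ∀ a → a ≗ c (D (constCode a))
  witness-inverts-c {D} refutes a =
    stable (proj₂ (refutes (constCode a)) a (ΦGraph-constCode a (D (constCode a))))

  not-effectively-discontinuous : ¬ EffectivelyDiscontinuous (Avoiding c)
  not-effectively-discontinuous (D , D-cont , D-spec)
    with y , small , G , task-y , G≗E ← task-scheduled 1 (∘-continuous D-cont constCode-continuous)
    with lem (∃ λ a → ¬ FixedBefore y (G a))
  ... | yes pending =
    let a , stage-y = stage-acts y task-y pending
    in 1+n≢n (sym (trans (witness-inverts-c D-spec a 0) (cong-app (c-at-stage stage-y (G≗E a)) 0)))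
  ... | no ¬pending = small (outValue ∘ stage) λ b →
    let y′ , y′⊏y , defines = stable {FixedBefore y (G b)} (λ ¬fixed → ¬pending (b , ¬fixed))
        c-Eb = c-defined (Defines-≗ (stage y′) (G≗E b) defines)
    in y′ , y′⊏y , λ i → trans (sym (cong-app c-Eb i)) (sym (witness-inverts-c D-spec b i))

corollary22 : ExcludedMiddle → WellOrderingTheorem →
    Σ Problem λ f → Discontinuous f × ¬ EffectivelyDiscontinuous f
corollary22 lem wot =
  let _ , sto , wf = wot Baire
      open Construction lem sto wf
  in Avoiding c , discontinuous , not-effectively-discontinuous
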